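{- Let $T$ be the low-defect tree of a low-defect expression $E$, and let $f$ be the low-defect polynomial of $E$. Then the leading coefficient of $f$ (the coefficient of the product of all its variables) equals the product of the vertex labels of $T$.
   Context: Low-defect expressions: (a) every positive integer constant is one; (b) the product of two low-defect expressions with disjoint variable sets is one; (c) if $E$ is one, $c$ a positive integer and $x$ a variable not in $E$, then $E\cdot x+c$ is one. Evaluating $E$ gives its low-defect polynomial $f$. The low-defect tree $T$ of $E$ is a rooted tree with vertices and edges labeled by positive integers: if $E$ is a constant $n$, $T$ is a single vertex labeled $n$; if $E=E'\cdot x+c$ with tree $T'$, $T$ is $T'$ with a new root labeled $1$ joined to the root of $T'$ by an edge labeled $c$; if $E=E_1\cdot E_2$ with trees $T_1,T_2$, $T$ is obtained by removing both roots and adding a new root, labeled by the product of the old root labels, adjacent to all vertices previously adjacent to either old root, with edge labels kept. -}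

module Defs where

open import Data.Nat using (ℕ; _+_; _*_; _≟_; _≥_)
open import Data.Bool using (Bool; true; false; if_then_else_; _∧_)
open import Data.List using (List; []; _∷_; _++_; map; concatMap; filter; length)
open import Data.List.Membership.Propositional using (_∉_)
open import Data.List.Relation.Binary.Disjoint.Propositional using (Disjoint)
open import Data.Product using (_×_; _,_; proj₁; proj₂)
open import Relation.Nullary.Decidable using (⌊_⌋)

Var : Set
Var = ℕ

data Expr : Set where
  const  : ℕ → Expr
  _⊗_    : Expr → Expr → Expr
  lin    : Expr → Var → ℕ → Expr          -- lin E x c  stands for  E·x + c

vars : Expr → List Var
vars (const n)   = []
vars (e₁ ⊗ e₂)   = vars e₁ ++ vars e₂
vars (lin e x c) = vars e ++ (x ∷ [])

data LowDefect : Expr → Set where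
  ld-const : ∀ {n} → n ≥ 1 → LowDefect (const n)
  ld-mul   : ∀ {e₁ e₂} → LowDefect e₁ → LowDefect e₂ →
             Disjoint (vars e₁) (vars e₂) → LowDefect (e₁ ⊗ e₂)
  ld-lin   : ∀ {e x c} → LowDefect e → c ≥ 1 → x ∉ vars e →
             LowDefect (lin e x c)

-- Polynomials with natural-number coefficients, as formal sums of terms
-- (coefficient , monomial); a monomial is a list of variables read as
-- their product (i.e. as a multiset of variables).

Monomial : Set
Monomial = List Var

Poly : Set
Poly = List (ℕ × Monomial)

count : Var → Monomial → ℕ
count v m = length (filter (λ w → v ≟ w) m)

allB : {A : Set} → (A → Bool) → List A → Bool
allB p []       = true
allB p (x ∷ xs) = p x ∧ allB p xs

sameMonomial : Monomial → Monomial → Bool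
sameMonomial m m' = allB (λ v → ⌊ count v m ≟ count v m' ⌋) (m ++ m')

coeff : Poly → Monomial → ℕ
coeff []            m = 0
coeff ((a , t) ∷ p) m = (if sameMonomial t m then a else 0) + coeff p m

polyMul : Poly → Poly → Poly
polyMul p q = concatMap (λ s → map (λ t → (proj₁ s * proj₁ t , proj₂ s ++ proj₂ t)) q) p

evalPoly : Expr → Poly
evalPoly (const n)   = (n , []) ∷ []
evalPoly (e₁ ⊗ e₂)   = polyMul (evalPoly e₁) (evalPoly e₂)
evalPoly (lin e x c) = map (λ s → (proj₁ s , proj₂ s ++ (x ∷ []))) (evalPoly e) ++ ((c , []) ∷ [])

leadingCoeff : Expr → ℕ
leadingCoeff e = coeff (evalPoly e) (vars e)

-- Rooted trees with vertex labels; each child carries the label of the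
-- edge joining it to its parent.

data Tree : Set where
  node : ℕ → List (ℕ × Tree) → Tree

rootLabel : Tree → ℕ
rootLabel (node n _) = n

children : Tree → List (ℕ × Tree)
children (node _ cs) = cs

ldTree : Expr → Tree
ldTree (const n)   = node n []
ldTree (e₁ ⊗ e₂)   = node (rootLabel (ldTree e₁) * rootLabel (ldTree e₂))
                          (children (ldTree e₁) ++ children (ldTree e₂))
ldTree (lin e x c) = node 1 ((c , ldTree e) ∷ [])

mutual
  vertexProduct : Tree → ℕ
  vertexProduct (node n cs) = n * childrenProduct cs

  childrenProduct : List (ℕ × Tree) → ℕ
  childrenProduct []             = 1
  childrenProduct ((_ , t) ∷ cs) = vertexProduct t * childrenProduct cs

-- The monomial vars e occurs in evalPoly e exactly once, with coefficient
-- vertexProduct (ldTree e), and every other monomial of evalPoly e divides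
-- vars e properly.  This invariant survives both constructions: in a product
-- of two such polynomials only top × top reaches the product of the top
-- monomials, and in E·x + c every term is shifted by x except the constant c,
-- which misses x.  Multiplying roots and concatenating children multiplies
-- vertex products in the same way.
module Submission where

open import Data.Nat using (ℕ; _+_; _*_; _≤_; _<_; _≟_; z≤n)
open import Data.Nat.Properties
open import Data.Bool using (Bool; true; false; if_then_else_)
open import Data.List using (List; []; _∷_; _++_; map; concat; filter; length)
open import Data.List.Properties using (length-++; map-++; ++-assoc; concat-++; filter-++; filter-accept)
open import Data.List.Membership.Propositional using (_∈_)
open import Data.List.Membership.Propositional.Properties using (∈-++⁺ˡ; ∈-++⁺ʳ)
open import Data.List.Relation.Unary.Any using (here; there)
open import Data.List.Relation.Unary.All as All using (All; []; _∷_)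
open import Data.List.Relation.Unary.All.Properties using (++⁺; map⁺; concat⁺)
open import Data.Product using (∃-syntax; _×_; _,_; proj₁; proj₂)
open import Relation.Nullary.Decidable using (⌊_⌋; isYes≗does; dec-true; dec-false)
open import Relation.Binary.PropositionalEquality
  using (_≡_; refl; sym; trans; cong; cong₂; subst; subst₂; module ≡-Reasoning)

open import Defs

count-++ : ∀ v (s t : Monomial) → count v (s ++ t) ≡ count v s + count v t
count-++ v s t = trans (cong length (filter-++ (v ≟_) s t)) (length-++ (filter (v ≟_) s))

count-self : ∀ v → count v (v ∷ []) ≡ 1
count-self v = cong length (filter-accept (v ≟_) {v} {[]} refl)

infix 4 _≤ₘ_ _<ₘ_

record _≤ₘ_ (t m : Monomial) : Set where
  constructor mk≤ₘ
  field count-≤ : ∀ v → count v t ≤ count v m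
open _≤ₘ_

-- The deficient variable is required to occur in m because sameMonomial
-- compares counts only at the variables of its two arguments.
_<ₘ_ : Monomial → Monomial → Set
t <ₘ m = t ≤ₘ m × ∃[ v ] (v ∈ m × count v t < count v m)

≤ₘ-refl : ∀ m → m ≤ₘ m
≤ₘ-refl m = mk≤ₘ λ v → ≤-refl

[]≤ₘ : ∀ m → [] ≤ₘ m
[]≤ₘ m = mk≤ₘ λ v → z≤n

++-mono-≤ₘ : ∀ {s t m₁ m₂} → s ≤ₘ m₁ → t ≤ₘ m₂ → s ++ t ≤ₘ m₁ ++ m₂
++-mono-≤ₘ {s} {t} {m₁} {m₂} s≤ t≤ = mk≤ₘ λ v →
  subst₂ _≤_ (sym (count-++ v s t)) (sym (count-++ v m₁ m₂)) (+-mono-≤ (count-≤ s≤ v) (count-≤ t≤ v))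

++-mono-<ₘ-≤ₘ : ∀ {s t m₁ m₂} → s <ₘ m₁ → t ≤ₘ m₂ → s ++ t <ₘ m₁ ++ m₂
++-mono-<ₘ-≤ₘ {s} {t} {m₁} {m₂} (s≤ , v , v∈ , s<) t≤ =
  ++-mono-≤ₘ s≤ t≤ , v , ∈-++⁺ˡ v∈ ,
  subst₂ _<_ (sym (count-++ v s t)) (sym (count-++ v m₁ m₂)) (+-mono-<-≤ s< (count-≤ t≤ v))

++-mono-≤ₘ-<ₘ : ∀ {s t m₁ m₂} → s ≤ₘ m₁ → t <ₘ m₂ → s ++ t <ₘ m₁ ++ m₂
++-mono-≤ₘ-<ₘ {s} {t} {m₁} {m₂} s≤ (t≤ , v , v∈ , t<) =
  ++-mono-≤ₘ s≤ t≤ , v , ∈-++⁺ʳ m₁ v∈ ,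
  subst₂ _<_ (sym (count-++ v s t)) (sym (count-++ v m₁ m₂)) (+-mono-≤-< (count-≤ s≤ v) t<)

[]<ₘ[x] : ∀ x → [] <ₘ x ∷ []
[]<ₘ[x] x = []≤ₘ (x ∷ []) , x , here refl , subst (0 <_) (sym (count-self x)) ≤-refl

allB-true : ∀ {A : Set} (p : A → Bool) (l : List A) → (∀ x → p x ≡ true) → allB p l ≡ true
allB-true p []      p≡true = refl
allB-true p (x ∷ l) p≡true rewrite p≡true x = allB-true p l p≡true

allB-false : ∀ {A : Set} (p : A → Bool) {x} (l : List A) → x ∈ l → p x ≡ false → allB p l ≡ false
allB-false p (x ∷ l) (here refl) px≡false rewrite px≡false = refl
allB-false p (y ∷ l) (there x∈l) px≡false with p y
... | true  = allB-false p l x∈l px≡false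
... | false = refl

sameMonomial-refl : ∀ m → sameMonomial m m ≡ true
sameMonomial-refl m = allB-true _ (m ++ m) λ v → ≟-refl (count v m)
  where
  ≟-refl : ∀ n → ⌊ n ≟ n ⌋ ≡ true
  ≟-refl n = trans (isYes≗does (n ≟ n)) (dec-true (n ≟ n) refl)

sameMonomial-<ₘ : ∀ {t m} → t <ₘ m → sameMonomial t m ≡ false
sameMonomial-<ₘ {t} {m} (_ , v , v∈m , t<m) =
  allB-false _ (t ++ m) (∈-++⁺ʳ t v∈m)
    (trans (isYes≗does (count v t ≟ count v m)) (dec-false (count v t ≟ count v m) (<⇒≢ t<m)))

Below : Monomial → ℕ × Monomial → Set
Below m term = proj₂ term <ₘ m

Bounded : Monomial → ℕ × Monomial → Set
Bounded m term = proj₂ term ≤ₘ m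

record LeadingTerm (p : Poly) (m : Monomial) (a : ℕ) : Set where
  constructor leadingTerm
  field
    before after : Poly
    split        : p ≡ before ++ (a , m) ∷ after
    before-below : All (Below m) before
    after-below  : All (Below m) after

coeff-++ : ∀ p q m → coeff (p ++ q) m ≡ coeff p m + coeff q m
coeff-++ []            q m = refl
coeff-++ ((a , t) ∷ p) q m rewrite coeff-++ p q m =
  sym (+-assoc (if sameMonomial t m then a else 0) (coeff p m) (coeff q m))

coeff-below : ∀ {p m} → All (Below m) p → coeff p m ≡ 0
coeff-below {[]}          []           = refl
coeff-below {(a , t) ∷ p} (t<m ∷ p<m) rewrite sameMonomial-<ₘ t<m = coeff-below p<m

coeff-leadingTerm : ∀ {p m a} → LeadingTerm p m a → coeff p m ≡ a
coeff-leadingTerm {m = m} {a} (leadingTerm p₁ p₂ refl p₁<m p₂<m) = begin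
  coeff (p₁ ++ (a , m) ∷ p₂) m
    ≡⟨ coeff-++ p₁ _ m ⟩
  coeff p₁ m + ((if sameMonomial m m then a else 0) + coeff p₂ m)
    ≡⟨ cong₂ _+_ (coeff-below p₁<m) (cong₂ _+_ top≡a (coeff-below p₂<m)) ⟩
  a + 0
    ≡⟨ +-identityʳ a ⟩
  a ∎
  where
  open ≡-Reasoning
  top≡a : (if sameMonomial m m then a else 0) ≡ a
  top≡a rewrite sameMonomial-refl m = refl

leadingTerm⇒bounded : ∀ {p m a} → LeadingTerm p m a → All (Bounded m) p
leadingTerm⇒bounded {m = m} (leadingTerm _ _ refl p₁<m p₂<m) =
  ++⁺ (All.map proj₁ p₁<m) (≤ₘ-refl m ∷ All.map proj₁ p₂<m)

mulTerm : ℕ × Monomial → ℕ × Monomial → ℕ × Monomial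
mulTerm s t = (proj₁ s * proj₁ t , proj₂ s ++ proj₂ t)

polyMul-++ : ∀ p₁ p₂ q → polyMul (p₁ ++ p₂) q ≡ polyMul p₁ q ++ polyMul p₂ q
polyMul-++ p₁ p₂ q =
  trans (cong concat (map-++ row p₁ p₂)) (sym (concat-++ (map row p₁) (map row p₂)))
  where
  row : ℕ × Monomial → Poly
  row s = map (mulTerm s) q

polyMul-below : ∀ {p q m₁ m₂} → All (Below m₁) p → All (Bounded m₂) q →
                All (Below (m₁ ++ m₂)) (polyMul p q)
polyMul-below p<m₁ q≤m₂ =
  concat⁺ (map⁺ (All.map (λ s<m₁ → map⁺ (All.map (++-mono-<ₘ-≤ₘ s<m₁) q≤m₂)) p<m₁))

map-mulTerm-below : ∀ {q m₂} a m₁ → All (Below m₂) q →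
                    All (Below (m₁ ++ m₂)) (map (mulTerm (a , m₁)) q)
map-mulTerm-below a m₁ q<m₂ = map⁺ (All.map (++-mono-≤ₘ-<ₘ (≤ₘ-refl m₁)) q<m₂)

leadingTerm-polyMul : ∀ {p q m₁ m₂ a b} → LeadingTerm p m₁ a → LeadingTerm q m₂ b →
                      LeadingTerm (polyMul p q) (m₁ ++ m₂) (a * b)
leadingTerm-polyMul {q = q} {m₁} {m₂} {a} {b}
  (leadingTerm p₁ p₂ refl p₁<m₁ p₂<m₁) lq@(leadingTerm q₁ q₂ refl q₁<m₂ q₂<m₂) =
  leadingTerm (polyMul p₁ q ++ map top q₁) (map top q₂ ++ polyMul p₂ q) split
    (++⁺ (polyMul-below p₁<m₁ q≤m₂) (map-mulTerm-below a m₁ q₁<m₂))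
    (++⁺ (map-mulTerm-below a m₁ q₂<m₂) (polyMul-below p₂<m₁ q≤m₂))
  where
  open ≡-Reasoning
  top : ℕ × Monomial → ℕ × Monomial
  top = mulTerm (a , m₁)
  q≤m₂ : All (Bounded m₂) q
  q≤m₂ = leadingTerm⇒bounded lq
  split : polyMul (p₁ ++ (a , m₁) ∷ p₂) q ≡
          (polyMul p₁ q ++ map top q₁) ++ (a * b , m₁ ++ m₂) ∷ (map top q₂ ++ polyMul p₂ q)
  split = begin
    polyMul (p₁ ++ (a , m₁) ∷ p₂) q
      ≡⟨ polyMul-++ p₁ _ q ⟩
    polyMul p₁ q ++ (map top q ++ polyMul p₂ q)
      ≡⟨ cong (λ r → polyMul p₁ q ++ (r ++ polyMul p₂ q)) (map-++ top q₁ _) ⟩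
    polyMul p₁ q ++ ((map top q₁ ++ top (b , m₂) ∷ map top q₂) ++ polyMul p₂ q)
      ≡⟨ cong (polyMul p₁ q ++_) (++-assoc (map top q₁) _ _) ⟩
    polyMul p₁ q ++ (map top q₁ ++ top (b , m₂) ∷ (map top q₂ ++ polyMul p₂ q))
      ≡⟨ ++-assoc (polyMul p₁ q) _ _ ⟨
    (polyMul p₁ q ++ map top q₁) ++ (a * b , m₁ ++ m₂) ∷ (map top q₂ ++ polyMul p₂ q) ∎

extendTerm : Var → ℕ × Monomial → ℕ × Monomial
extendTerm x t = (proj₁ t , proj₂ t ++ x ∷ [])

extendTerm-below : ∀ {p m} x → All (Below m) p → All (Below (m ++ x ∷ [])) (map (extendTerm x) p)
extendTerm-below x p<m = map⁺ (All.map (λ t<m → ++-mono-<ₘ-≤ₘ t<m (≤ₘ-refl (x ∷ []))) p<m)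

leadingTerm-lin : ∀ {p m a} x c → LeadingTerm p m a →
                  LeadingTerm (map (extendTerm x) p ++ (c , []) ∷ []) (m ++ x ∷ []) a
leadingTerm-lin {m = m} {a} x c (leadingTerm p₁ p₂ refl p₁<m p₂<m) =
  leadingTerm (map (extendTerm x) p₁) (map (extendTerm x) p₂ ++ (c , []) ∷ []) split
    (extendTerm-below x p₁<m)
    (++⁺ (extendTerm-below x p₂<m) (++-mono-≤ₘ-<ₘ ([]≤ₘ m) ([]<ₘ[x] x) ∷ []))
  where
  split : map (extendTerm x) (p₁ ++ (a , m) ∷ p₂) ++ (c , []) ∷ [] ≡
          map (extendTerm x) p₁ ++ (a , m ++ x ∷ []) ∷ (map (extendTerm x) p₂ ++ (c , []) ∷ [])
  split = trans (cong (_++ (c , []) ∷ []) (map-++ (extendTerm x) p₁ _))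
                (++-assoc (map (extendTerm x) p₁) _ _)

childrenProduct-++ : ∀ cs₁ cs₂ → childrenProduct (cs₁ ++ cs₂) ≡ childrenProduct cs₁ * childrenProduct cs₂
childrenProduct-++ []              cs₂ = sym (+-identityʳ (childrenProduct cs₂))
childrenProduct-++ ((_ , t) ∷ cs₁) cs₂ rewrite childrenProduct-++ cs₁ cs₂ =
  sym (*-assoc (vertexProduct t) (childrenProduct cs₁) (childrenProduct cs₂))

vertexProduct-mergeRoots : ∀ t₁ t₂ →
  vertexProduct (node (rootLabel t₁ * rootLabel t₂) (children t₁ ++ children t₂)) ≡
  vertexProduct t₁ * vertexProduct t₂
vertexProduct-mergeRoots (node r₁ cs₁) (node r₂ cs₂) rewrite childrenProduct-++ cs₁ cs₂ =
  [m*n]*[o*p]≡[m*o]*[n*p] r₁ r₂ (childrenProduct cs₁) (childrenProduct cs₂)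

vertexProduct-newRoot : ∀ c t → vertexProduct (node 1 ((c , t) ∷ [])) ≡ vertexProduct t
vertexProduct-newRoot c t = trans (+-identityʳ (vertexProduct t * 1)) (*-identityʳ (vertexProduct t))

leadingTerm-evalPoly : ∀ e → LeadingTerm (evalPoly e) (vars e) (vertexProduct (ldTree e))
leadingTerm-evalPoly (const n) =
  leadingTerm [] [] (cong (λ k → (k , []) ∷ []) (sym (*-identityʳ n))) [] []
leadingTerm-evalPoly (e₁ ⊗ e₂) =
  subst (LeadingTerm (evalPoly (e₁ ⊗ e₂)) (vars (e₁ ⊗ e₂)))
    (sym (vertexProduct-mergeRoots (ldTree e₁) (ldTree e₂)))
    (leadingTerm-polyMul (leadingTerm-evalPoly e₁) (leadingTerm-evalPoly e₂))
leadingTerm-evalPoly (lin e x c) =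
  subst (LeadingTerm (evalPoly (lin e x c)) (vars (lin e x c)))
    (sym (vertexProduct-newRoot c (ldTree e)))
    (leadingTerm-lin x c (leadingTerm-evalPoly e))

corollary3p16 : (e : Expr) → LowDefect e → leadingCoeff e ≡ vertexProduct (ldTree e)
corollary3p16 e _ = coeff-leadingTerm (leadingTerm-evalPoly e)
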